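{- A cartesian symmetric monoidal closed category $\mathcal L$ is canonically summable if and only if $w_0,w_1\in\mathcal L(1,I)$ are jointly epic and $(S,\pi_0,\pi_1,\sigma)$ satisfies (S-witness).
   Context: $\mathcal L$ is a symmetric monoidal closed category (internal hom $\multimap$, evaluation $\mathrm{ev}$, unit $1$, right unitor $\rho$) enriched over pointed sets (zero morphisms absorbing for composition and tensor), with finite cartesian products $\&$. Let $I=1\& 1$, $S=I\multimap-$, $w_0=\langle\mathrm{id}_1,0\rangle$, $w_1=\langle0,\mathrm{id}_1\rangle$, $\Delta=\langle\mathrm{id}_1,\mathrm{id}_1\rangle\in\mathcal L(1,I)$; for $\phi\in\mathcal L(1,I)$, $\bar\phi_X=\mathrm{ev}\circ((I\multimap X)\otimes\phi)\circ\rho^{ -1}$; $\pi_i=\bar w_i$, $\sigma=\bar\Delta$. Given such a tuple, $f_0,f_1\in\mathcal L(X,Y)$ are summable if there is $g\in\mathcal L(X,SY)$ with $\pi_i g=f_i$ (written $\langle f_0,f_1\rangle_S$ when unique), and $f_0+f_1=\sigma\langle f_0,f_1\rangle_S$. (S-witness): if $(f_{00},f_{01})$, $(f_{10},f_{11})$ are summable and $(f_{00}+f_{01},f_{10}+f_{11})$ is summable, then $\langle f_{00},f_{01}\rangle_S,\langle f_{10},f_{11}\rangle_S$ are summable. $\mathcal L$ is canonically summable if $(S,\pi_0,\pi_1,\sigma)$ is a summability structure: $S0=0$, $\pi_0,\pi_1$ jointly monic, and (S-com) $\pi_1,\pi_0$ summable with $\sigma\langle\pi_1,\pi_0\rangle_S=\sigma$;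 (S-zero) $f,0$ summable with $f+0=f$; (S-witness); (S-assoc) $S\sigma_X\circ c_X=\sigma_{SX}$ where $c_X$ is the unique endomorphism of $S^2X$ with $\pi_{i,X}\pi_{j,SX}c_X=\pi_{j,X}\pi_{i,SX}$. -}

module Defs where

open import Level using (Level; _⊔_) renaming (suc to lsuc)
open import Relation.Binary.PropositionalEquality using (_≡_)
open import Data.Product using (Σ; _×_; _,_; ∃-syntax)
open import Data.Bool using (Bool; false; true)

-- A symmetric monoidal closed category with finite (cartesian) products,
-- enriched over pointed sets (zero morphisms absorbing for composition
-- and tensor).  Hom-sets are types; equality of morphisms is _≡_.
record CartesianPointedSMCC (o ℓ : Level) : Set (lsuc (o ⊔ ℓ)) where
  infixr 9 _∘_
  infix 4 _⇒_
  infixr 10 _⊗₀_ _⊗₁_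
  infixr 8 _⊸_
  infixr 11 _&_
  field
    Obj : Set o
    _⇒_ : Obj → Obj → Set ℓ
    id : ∀ {A} → A ⇒ A
    _∘_ : ∀ {A B C} → B ⇒ C → A ⇒ B → A ⇒ C
    identityˡ : ∀ {A B} {f : A ⇒ B} → id ∘ f ≡ f
    identityʳ : ∀ {A B} {f : A ⇒ B} → f ∘ id ≡ f
    assoc : ∀ {A B C D} {f : A ⇒ B} {g : B ⇒ C} {h : C ⇒ D} →
            (h ∘ g) ∘ f ≡ h ∘ (g ∘ f)

    0m : ∀ {A B} → A ⇒ B
    zeroˡ : ∀ {A B C} {f : A ⇒ B} → 0m {B} {C} ∘ f ≡ 0m
    zeroʳ : ∀ {A B C} {g : B ⇒ C} → g ∘ 0m {A} {B} ≡ 0m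

    𝟙 : Obj
    _⊗₀_ : Obj → Obj → Obj
    _⊗₁_ : ∀ {A B C D} → A ⇒ B → C ⇒ D → (A ⊗₀ C) ⇒ (B ⊗₀ D)
    ⊗-id : ∀ {A B} → id {A} ⊗₁ id {B} ≡ id
    ⊗-∘ : ∀ {A B C D E F} {f : A ⇒ B} {g : B ⇒ C} {h : D ⇒ E} {k : E ⇒ F} →
          (g ∘ f) ⊗₁ (k ∘ h) ≡ (g ⊗₁ k) ∘ (f ⊗₁ h)
    ⊗-zeroˡ : ∀ {A B C D} {g : C ⇒ D} → 0m {A} {B} ⊗₁ g ≡ 0m
    ⊗-zeroʳ : ∀ {A B C D} {f : A ⇒ B} → f ⊗₁ 0m {C} {D} ≡ 0m

    λ⇒ : ∀ {A} → 𝟙 ⊗₀ A ⇒ A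
    λ⇐ : ∀ {A} → A ⇒ 𝟙 ⊗₀ A
    λ-isoˡ : ∀ {A} → λ⇐ {A} ∘ λ⇒ ≡ id
    λ-isoʳ : ∀ {A} → λ⇒ {A} ∘ λ⇐ ≡ id
    λ-nat : ∀ {A B} {f : A ⇒ B} → f ∘ λ⇒ ≡ λ⇒ ∘ (id ⊗₁ f)

    ρ⇒ : ∀ {A} → A ⊗₀ 𝟙 ⇒ A
    ρ⇐ : ∀ {A} → A ⇒ A ⊗₀ 𝟙
    ρ-isoˡ : ∀ {A} → ρ⇐ {A} ∘ ρ⇒ ≡ id
    ρ-isoʳ : ∀ {A} → ρ⇒ {A} ∘ ρ⇐ ≡ id
    ρ-nat : ∀ {A B} {f : A ⇒ B} → f ∘ ρ⇒ ≡ ρ⇒ ∘ (f ⊗₁ id)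

    α⇒ : ∀ {A B C} → (A ⊗₀ B) ⊗₀ C ⇒ A ⊗₀ (B ⊗₀ C)
    α⇐ : ∀ {A B C} → A ⊗₀ (B ⊗₀ C) ⇒ (A ⊗₀ B) ⊗₀ C
    α-isoˡ : ∀ {A B C} → α⇐ {A} {B} {C} ∘ α⇒ ≡ id
    α-isoʳ : ∀ {A B C} → α⇒ {A} {B} {C} ∘ α⇐ ≡ id
    α-nat : ∀ {A A′ B B′ C C′} {f : A ⇒ A′} {g : B ⇒ B′} {h : C ⇒ C′} →
            (f ⊗₁ (g ⊗₁ h)) ∘ α⇒ ≡ α⇒ ∘ ((f ⊗₁ g) ⊗₁ h)

    γ : ∀ {A B} → A ⊗₀ B ⇒ B ⊗₀ A
    γ-inv : ∀ {A B} → γ {B} {A} ∘ γ {A} {B} ≡ id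
    γ-nat : ∀ {A A′ B B′} {f : A ⇒ A′} {g : B ⇒ B′} →
            (g ⊗₁ f) ∘ γ ≡ γ ∘ (f ⊗₁ g)

    triangle : ∀ {A B} → (id {A} ⊗₁ λ⇒ {B}) ∘ α⇒ ≡ ρ⇒ ⊗₁ id
    pentagon : ∀ {A B C D} →
               (id {A} ⊗₁ α⇒ {B} {C} {D}) ∘ (α⇒ ∘ (α⇒ ⊗₁ id))
                 ≡ α⇒ ∘ α⇒
    hexagon : ∀ {A B C} →
              (id {B} ⊗₁ γ {A} {C}) ∘ (α⇒ ∘ (γ ⊗₁ id))
                ≡ α⇒ ∘ (γ ∘ α⇒)

    _⊸_ : Obj → Obj → Obj
    ev : ∀ {A B} → (A ⊸ B) ⊗₀ A ⇒ B
    curry : ∀ {C A B} → C ⊗₀ A ⇒ B → C ⇒ A ⊸ B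
    ev-curry : ∀ {C A B} {f : C ⊗₀ A ⇒ B} → ev ∘ (curry f ⊗₁ id) ≡ f
    curry-unique : ∀ {C A B} {f : C ⊗₀ A ⇒ B} {g : C ⇒ A ⊸ B} →
                   ev ∘ (g ⊗₁ id) ≡ f → g ≡ curry f

    _&_ : Obj → Obj → Obj
    p₁ : ∀ {A B} → A & B ⇒ A
    p₂ : ∀ {A B} → A & B ⇒ B
    ⟨_,_⟩ : ∀ {C A B} → C ⇒ A → C ⇒ B → C ⇒ A & B
    p₁-β : ∀ {C A B} {f : C ⇒ A} {g : C ⇒ B} → p₁ ∘ ⟨ f , g ⟩ ≡ f
    p₂-β : ∀ {C A B} {f : C ⇒ A} {g : C ⇒ B} → p₂ ∘ ⟨ f , g ⟩ ≡ g
    pair-unique : ∀ {C A B} {f : C ⇒ A} {g : C ⇒ B} {h : C ⇒ A & B} →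
                  p₁ ∘ h ≡ f → p₂ ∘ h ≡ g → h ≡ ⟨ f , g ⟩
    ⊤ : Obj
    ! : ∀ {A} → A ⇒ ⊤
    !-unique : ∀ {A} (f : A ⇒ ⊤) → f ≡ !

module Summability {o ℓ} (L : CartesianPointedSMCC o ℓ) where
  open CartesianPointedSMCC L

  I : Obj
  I = 𝟙 & 𝟙

  S : Obj → Obj
  S X = I ⊸ X

  S₁ : ∀ {X Y} → X ⇒ Y → S X ⇒ S Y
  S₁ f = curry (f ∘ ev)

  w₀ w₁ Δ : 𝟙 ⇒ I
  w₀ = ⟨ id , 0m ⟩
  w₁ = ⟨ 0m , id ⟩
  Δ  = ⟨ id , id ⟩

  bar : 𝟙 ⇒ I → ∀ {X} → S X ⇒ X
  bar φ {X} = ev ∘ ((id {S X} ⊗₁ φ) ∘ ρ⇐)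

  π₀ π₁ σ : ∀ {X} → S X ⇒ X
  π₀ = bar w₀
  π₁ = bar w₁
  σ  = bar Δ

  π : Bool → ∀ {X} → S X ⇒ X
  π false = π₀
  π true  = π₁

  IsWitness : ∀ {X Y} → X ⇒ Y → X ⇒ Y → X ⇒ S Y → Set ℓ
  IsWitness f₀ f₁ g = (π₀ ∘ g ≡ f₀) × (π₁ ∘ g ≡ f₁)

  Summable : ∀ {X Y} → X ⇒ Y → X ⇒ Y → Set ℓ
  Summable f₀ f₁ = ∃[ g ] IsWitness f₀ f₁ g

  IsZeroObject : Obj → Set (o ⊔ ℓ)
  IsZeroObject Z = (∀ {A} (f g : A ⇒ Z) → f ≡ g) × (∀ {A} (f g : Z ⇒ A) → f ≡ g)

  -- S0 = 0  (0 is the zero object, i.e. the terminal object ⊤)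
  S-preserves-zero : Set (o ⊔ ℓ)
  S-preserves-zero = IsZeroObject (S ⊤)

  π-jointly-monic : Set (o ⊔ ℓ)
  π-jointly-monic = ∀ {X Y} {f g : X ⇒ S Y} →
    π₀ ∘ f ≡ π₀ ∘ g → π₁ ∘ f ≡ π₁ ∘ g → f ≡ g

  S-com : Set (o ⊔ ℓ)
  S-com = ∀ {X} → ∃[ g ] (IsWitness (π₁ {X}) π₀ g × (σ ∘ g ≡ σ))

  S-zero : Set (o ⊔ ℓ)
  S-zero = ∀ {X Y} (f : X ⇒ Y) → ∃[ g ] (IsWitness f 0m g × (σ ∘ g ≡ f))

  S-witness : Set (o ⊔ ℓ)
  S-witness = ∀ {X Y} {f₀₀ f₀₁ f₁₀ f₁₁ : X ⇒ Y} {g₀ g₁ : X ⇒ S Y} →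
    IsWitness f₀₀ f₀₁ g₀ → IsWitness f₁₀ f₁₁ g₁ →
    Summable (σ ∘ g₀) (σ ∘ g₁) → Summable g₀ g₁

  S-assoc : Set (o ⊔ ℓ)
  S-assoc = ∀ {X} → ∃[ c ]
    ((∀ i j → π i {X} ∘ (π j {S X} ∘ c) ≡ π j {X} ∘ π i {S X})
     × (S₁ (σ {X}) ∘ c ≡ σ {S X}))

  IsSummabilityStructure : Set (o ⊔ ℓ)
  IsSummabilityStructure =
    S-preserves-zero × π-jointly-monic × S-com × S-zero × S-witness × S-assoc

  CanonicallySummable : Set (o ⊔ ℓ)
  CanonicallySummable = IsSummabilityStructure

  w-jointly-epic : Set (o ⊔ ℓ)
  w-jointly-epic = ∀ {X} {f g : I ⇒ X} →
    f ∘ w₀ ≡ g ∘ w₀ → f ∘ w₁ ≡ g ∘ w₁ → f ≡ g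

module Submission where

-- Currying turns a generalised element f : X ⇒ S Y into a map X ⊗ I ⇒ Y, and
-- bar φ ∘ f into its restriction along id ⊗ φ.  Hence π₀, π₁ are jointly
-- monic exactly when w₀, w₁ are jointly epic.  The remaining axioms of a
-- summability structure hold in any such category: S ⊤ is a zero object, and
-- (S-com), (S-zero) are witnessed by reindexing along the swap of I and along
-- its first projection.  Only (S-assoc) needs (S-witness): the exchange map c
-- is a witness for the pair (S π₀ , S π₁), whose sums π₀ σ and π₁ σ are
-- witnessed by σ itself.

open import Data.Bool using (false; true)
open import Data.Product using (_×_; _,_)
open import Relation.Binary.PropositionalEquality
  using (_≡_; refl; sym; trans; cong; module ≡-Reasoning)

open import Defs

module CanonicalSummability {o ℓ} (L : CartesianPointedSMCC o ℓ) where
  open CartesianPointedSMCC L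
  open Summability L
  open ≡-Reasoning

  splitEpi-cancelʳ : ∀ {A B C} {a b : B ⇒ A} {r : C ⇒ B} {s : B ⇒ C} →
                     r ∘ s ≡ id → a ∘ r ≡ b ∘ r → a ≡ b
  splitEpi-cancelʳ {a = a} {b} {r} {s} r∘s≡id a∘r≡b∘r = begin
    a            ≡⟨ sym identityʳ ⟩
    a ∘ id       ≡⟨ cong (a ∘_) (sym r∘s≡id) ⟩
    a ∘ (r ∘ s)  ≡⟨ sym assoc ⟩
    (a ∘ r) ∘ s  ≡⟨ cong (_∘ s) a∘r≡b∘r ⟩
    (b ∘ r) ∘ s  ≡⟨ assoc ⟩
    b ∘ (r ∘ s)  ≡⟨ cong (b ∘_) r∘s≡id ⟩
    b ∘ id       ≡⟨ identityʳ ⟩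
    b            ∎

  swap : ∀ {A B} → A & B ⇒ B & A
  swap = ⟨ p₂ , p₁ ⟩

  swap∘⟨⟩ : ∀ {C A B} {a : C ⇒ A} {b : C ⇒ B} → swap ∘ ⟨ a , b ⟩ ≡ ⟨ b , a ⟩
  swap∘⟨⟩ = pair-unique (trans (sym assoc) (trans (cong (_∘ _) p₁-β) p₂-β))
                        (trans (sym assoc) (trans (cong (_∘ _) p₂-β) p₁-β))

  id⊗-∘ : ∀ {A B C D} {a : C ⇒ D} {b : B ⇒ C} →
          (id {A} ⊗₁ a) ∘ (id ⊗₁ b) ≡ id ⊗₁ (a ∘ b)
  id⊗-∘ = trans (sym ⊗-∘) (cong (_⊗₁ _) identityˡ)

  ⊗-interchange : ∀ {A B C D} (g : A ⇒ B) (φ : C ⇒ D) →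
                  (id ⊗₁ φ) ∘ (g ⊗₁ id) ≡ (g ⊗₁ id) ∘ (id ⊗₁ φ)
  ⊗-interchange g φ = begin
    (id ⊗₁ φ) ∘ (g ⊗₁ id)  ≡⟨ sym ⊗-∘ ⟩
    (id ∘ g) ⊗₁ (φ ∘ id)   ≡⟨ cong (_⊗₁ _) identityˡ ⟩
    g ⊗₁ (φ ∘ id)          ≡⟨ cong (g ⊗₁_) (trans identityʳ (sym identityˡ)) ⟩
    g ⊗₁ (id ∘ φ)          ≡⟨ cong (_⊗₁ _) (sym identityʳ) ⟩
    (g ∘ id) ⊗₁ (id ∘ φ)   ≡⟨ ⊗-∘ ⟩
    (g ⊗₁ id) ∘ (id ⊗₁ φ)  ∎

  ρ⇐-natural : ∀ {A B} (g : A ⇒ B) → ρ⇐ ∘ g ≡ (g ⊗₁ id) ∘ ρ⇐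
  ρ⇐-natural g = begin
    ρ⇐ ∘ g                         ≡⟨ cong (ρ⇐ ∘_) (sym identityʳ) ⟩
    ρ⇐ ∘ (g ∘ id)                  ≡⟨ cong (λ u → ρ⇐ ∘ (g ∘ u)) (sym ρ-isoʳ) ⟩
    ρ⇐ ∘ (g ∘ (ρ⇒ ∘ ρ⇐))           ≡⟨ cong (ρ⇐ ∘_) (sym assoc) ⟩
    ρ⇐ ∘ ((g ∘ ρ⇒) ∘ ρ⇐)           ≡⟨ cong (λ u → ρ⇐ ∘ (u ∘ ρ⇐)) ρ-nat ⟩
    ρ⇐ ∘ ((ρ⇒ ∘ (g ⊗₁ id)) ∘ ρ⇐)   ≡⟨ cong (ρ⇐ ∘_) assoc ⟩
    ρ⇐ ∘ (ρ⇒ ∘ ((g ⊗₁ id) ∘ ρ⇐))   ≡⟨ sym assoc ⟩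
    (ρ⇐ ∘ ρ⇒) ∘ ((g ⊗₁ id) ∘ ρ⇐)   ≡⟨ cong (_∘ ((g ⊗₁ id) ∘ ρ⇐)) ρ-isoˡ ⟩
    id ∘ ((g ⊗₁ id) ∘ ρ⇐)          ≡⟨ identityˡ ⟩
    (g ⊗₁ id) ∘ ρ⇐                 ∎

  uncurry : ∀ {C A B} → C ⇒ A ⊸ B → C ⊗₀ A ⇒ B
  uncurry f = ev ∘ (f ⊗₁ id)

  curry-injective : ∀ {C A B} {h k : C ⊗₀ A ⇒ B} → curry h ≡ curry k → h ≡ k
  curry-injective curry-h≡curry-k =
    trans (sym ev-curry) (trans (cong uncurry curry-h≡curry-k) ev-curry)

  uncurry-injective : ∀ {C A B} {f g : C ⇒ A ⊸ B} → uncurry f ≡ uncurry g → f ≡ g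
  uncurry-injective uf≡ug =
    trans (curry-unique refl) (trans (cong curry uf≡ug) (sym (curry-unique refl)))

  curry-∘ : ∀ {A B C D} (h : C ⊗₀ A ⇒ B) (k : D ⇒ C) →
            curry h ∘ k ≡ curry (h ∘ (k ⊗₁ id))
  curry-∘ h k = curry-unique (begin
    ev ∘ ((curry h ∘ k) ⊗₁ id)         ≡⟨ cong (λ u → ev ∘ ((curry h ∘ k) ⊗₁ u)) (sym identityˡ) ⟩
    ev ∘ ((curry h ∘ k) ⊗₁ (id ∘ id))  ≡⟨ cong (ev ∘_) ⊗-∘ ⟩
    ev ∘ ((curry h ⊗₁ id) ∘ (k ⊗₁ id)) ≡⟨ sym assoc ⟩
    uncurry (curry h) ∘ (k ⊗₁ id)      ≡⟨ cong (_∘ _) ev-curry ⟩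
    h ∘ (k ⊗₁ id)                      ∎)

  transpose : ∀ {A B C} → A ⊗₀ B ⇒ C → B ⇒ A ⊸ C
  transpose h = curry (h ∘ γ)

  transpose-∘ : ∀ {A B B′ C} (h : A ⊗₀ B ⇒ C) (w : B′ ⇒ B) →
                transpose h ∘ w ≡ transpose (h ∘ (id ⊗₁ w))
  transpose-∘ h w = trans (curry-∘ (h ∘ γ) w) (cong curry (begin
    (h ∘ γ) ∘ (w ⊗₁ id)    ≡⟨ assoc ⟩
    h ∘ (γ ∘ (w ⊗₁ id))    ≡⟨ cong (h ∘_) (sym γ-nat) ⟩
    h ∘ ((id ⊗₁ w) ∘ γ)    ≡⟨ sym assoc ⟩
    (h ∘ (id ⊗₁ w)) ∘ γ    ∎))

  transpose-injective : ∀ {A B C} {h k : A ⊗₀ B ⇒ C} → transpose h ≡ transpose k → h ≡ k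
  transpose-injective th≡tk = splitEpi-cancelʳ γ-inv (curry-injective th≡tk)

  pointʳ : ∀ {A B} → 𝟙 ⇒ B → A ⇒ A ⊗₀ B
  pointʳ φ = (id ⊗₁ φ) ∘ ρ⇐

  pointʳ-natural : ∀ {A A′ B} (g : A ⇒ A′) (φ : 𝟙 ⇒ B) →
                   pointʳ φ ∘ g ≡ (g ⊗₁ id) ∘ pointʳ φ
  pointʳ-natural g φ = begin
    ((id ⊗₁ φ) ∘ ρ⇐) ∘ g          ≡⟨ assoc ⟩
    (id ⊗₁ φ) ∘ (ρ⇐ ∘ g)          ≡⟨ cong ((id ⊗₁ φ) ∘_) (ρ⇐-natural g) ⟩
    (id ⊗₁ φ) ∘ ((g ⊗₁ id) ∘ ρ⇐)  ≡⟨ sym assoc ⟩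
    ((id ⊗₁ φ) ∘ (g ⊗₁ id)) ∘ ρ⇐  ≡⟨ cong (_∘ ρ⇐) (⊗-interchange g φ) ⟩
    ((g ⊗₁ id) ∘ (id ⊗₁ φ)) ∘ ρ⇐  ≡⟨ assoc ⟩
    (g ⊗₁ id) ∘ pointʳ φ          ∎

  id⊗-pointʳ : ∀ {A B C} (ψ : B ⇒ C) (φ : 𝟙 ⇒ B) →
               (id {A} ⊗₁ ψ) ∘ pointʳ φ ≡ pointʳ (ψ ∘ φ)
  id⊗-pointʳ ψ φ = trans (sym assoc) (cong (_∘ ρ⇐) id⊗-∘)

  pointʳ-id : ∀ {A} → ρ⇒ ∘ pointʳ id ≡ id {A}
  pointʳ-id = trans (cong (λ u → ρ⇒ ∘ (u ∘ ρ⇐)) ⊗-id)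
                    (trans (cong (ρ⇒ ∘_) identityˡ) ρ-isoʳ)

  pointʳ-zero : ∀ {A B} → pointʳ {A} {B} 0m ≡ 0m
  pointʳ-zero = trans (cong (_∘ ρ⇐) ⊗-zeroʳ) zeroˡ

  bar-∘ : ∀ (φ : 𝟙 ⇒ I) {A X} (f : A ⇒ S X) → bar φ ∘ f ≡ uncurry f ∘ pointʳ φ
  bar-∘ φ f = begin
    (ev ∘ pointʳ φ) ∘ f           ≡⟨ assoc ⟩
    ev ∘ (pointʳ φ ∘ f)           ≡⟨ cong (ev ∘_) (pointʳ-natural f φ) ⟩
    ev ∘ ((f ⊗₁ id) ∘ pointʳ φ)   ≡⟨ sym assoc ⟩
    uncurry f ∘ pointʳ φ          ∎

  bar-curry : ∀ (φ : 𝟙 ⇒ I) {A X} (h : A ⊗₀ I ⇒ X) → bar φ ∘ curry h ≡ h ∘ pointʳ φ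
  bar-curry φ h = trans (bar-∘ φ (curry h)) (cong (_∘ pointʳ φ) ev-curry)

  bar-natural : ∀ (φ : 𝟙 ⇒ I) {X Y} (f : X ⇒ Y) → bar φ ∘ S₁ f ≡ f ∘ bar φ
  bar-natural φ f = trans (bar-curry φ (f ∘ ev)) assoc

  π-natural : ∀ i {X Y} (f : X ⇒ Y) → π i ∘ S₁ f ≡ f ∘ π i
  π-natural false = bar-natural w₀
  π-natural true  = bar-natural w₁

  bar-cancel : ∀ (φ : 𝟙 ⇒ I) {X Y} {f g : X ⇒ S Y} →
               bar φ ∘ f ≡ bar φ ∘ g → uncurry f ∘ (id ⊗₁ φ) ≡ uncurry g ∘ (id ⊗₁ φ)
  bar-cancel φ {f = f} {g} e = splitEpi-cancelʳ ρ-isoˡ (begin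
    (uncurry f ∘ (id ⊗₁ φ)) ∘ ρ⇐  ≡⟨ assoc ⟩
    uncurry f ∘ pointʳ φ          ≡⟨ sym (bar-∘ φ f) ⟩
    bar φ ∘ f                     ≡⟨ e ⟩
    bar φ ∘ g                     ≡⟨ bar-∘ φ g ⟩
    uncurry g ∘ pointʳ φ          ≡⟨ sym assoc ⟩
    (uncurry g ∘ (id ⊗₁ φ)) ∘ ρ⇐  ∎)

  w-jointly-epic⇒π-jointly-monic : w-jointly-epic → π-jointly-monic
  w-jointly-epic⇒π-jointly-monic epic {f = f} {g} e₀ e₁ =
    uncurry-injective (transpose-injective (epic (transposed-agree w₀ e₀)
                                                 (transposed-agree w₁ e₁)))
    where
    transposed-agree : ∀ (w : 𝟙 ⇒ I) → bar w ∘ f ≡ bar w ∘ g →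
                       transpose (uncurry f) ∘ w ≡ transpose (uncurry g) ∘ w
    transposed-agree w e = begin
      transpose (uncurry f) ∘ w           ≡⟨ transpose-∘ (uncurry f) w ⟩
      transpose (uncurry f ∘ (id ⊗₁ w))   ≡⟨ cong transpose (bar-cancel w e) ⟩
      transpose (uncurry g ∘ (id ⊗₁ w))   ≡⟨ sym (transpose-∘ (uncurry g) w) ⟩
      transpose (uncurry g) ∘ w           ∎

  ⌜_⌝ : ∀ {X} → I ⇒ X → 𝟙 ⇒ S X
  ⌜ f ⌝ = curry (f ∘ λ⇒)

  bar-⌜⌝ : ∀ (φ : 𝟙 ⇒ I) {X} (f : I ⇒ X) → bar φ ∘ ⌜ f ⌝ ≡ (f ∘ φ) ∘ (λ⇒ ∘ ρ⇐)
  bar-⌜⌝ φ f = begin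
    bar φ ∘ ⌜ f ⌝                   ≡⟨ bar-curry φ (f ∘ λ⇒) ⟩
    (f ∘ λ⇒) ∘ ((id ⊗₁ φ) ∘ ρ⇐)     ≡⟨ assoc ⟩
    f ∘ (λ⇒ ∘ ((id ⊗₁ φ) ∘ ρ⇐))     ≡⟨ cong (f ∘_) (sym assoc) ⟩
    f ∘ ((λ⇒ ∘ (id ⊗₁ φ)) ∘ ρ⇐)     ≡⟨ cong (λ u → f ∘ (u ∘ ρ⇐)) (sym λ-nat) ⟩
    f ∘ ((φ ∘ λ⇒) ∘ ρ⇐)             ≡⟨ cong (f ∘_) assoc ⟩
    f ∘ (φ ∘ (λ⇒ ∘ ρ⇐))             ≡⟨ sym assoc ⟩
    (f ∘ φ) ∘ (λ⇒ ∘ ρ⇐)             ∎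

  π-jointly-monic⇒w-jointly-epic : π-jointly-monic → w-jointly-epic
  π-jointly-monic⇒w-jointly-epic monic {f = f} {g} e₀ e₁ =
    splitEpi-cancelʳ λ-isoʳ (curry-injective (monic (names-agree w₀ e₀) (names-agree w₁ e₁)))
    where
    names-agree : ∀ (w : 𝟙 ⇒ I) → f ∘ w ≡ g ∘ w → bar w ∘ ⌜ f ⌝ ≡ bar w ∘ ⌜ g ⌝
    names-agree w e = begin
      bar w ∘ ⌜ f ⌝          ≡⟨ bar-⌜⌝ w f ⟩
      (f ∘ w) ∘ (λ⇒ ∘ ρ⇐)    ≡⟨ cong (_∘ (λ⇒ ∘ ρ⇐)) e ⟩
      (g ∘ w) ∘ (λ⇒ ∘ ρ⇐)    ≡⟨ sym (bar-⌜⌝ w g) ⟩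
      bar w ∘ ⌜ g ⌝          ∎

  S⊤-isZeroObject : S-preserves-zero
  S⊤-isZeroObject = into-S⊤ , out-of-S⊤
    where
    into-S⊤ : ∀ {A} (f g : A ⇒ S ⊤) → f ≡ g
    into-S⊤ f g = uncurry-injective (trans (!-unique _) (sym (!-unique _)))
    out-of-S⊤-zero : ∀ {A} (f : S ⊤ ⇒ A) → f ≡ 0m
    out-of-S⊤-zero f = trans (sym identityʳ) (trans (cong (f ∘_) (into-S⊤ id 0m)) zeroʳ)
    out-of-S⊤ : ∀ {A} (f g : S ⊤ ⇒ A) → f ≡ g
    out-of-S⊤ f g = trans (out-of-S⊤-zero f) (sym (out-of-S⊤-zero g))

  reindex : ∀ {X} → I ⇒ I → S X ⇒ S X
  reindex ψ = curry (ev ∘ (id ⊗₁ ψ))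

  bar-reindex : ∀ {φ φ′ : 𝟙 ⇒ I} {ψ : I ⇒ I} {X} → ψ ∘ φ ≡ φ′ → bar φ {X} ∘ reindex ψ ≡ bar φ′
  bar-reindex {φ} {ψ = ψ} ψ∘φ≡φ′ = begin
    bar φ ∘ reindex ψ               ≡⟨ bar-curry φ (ev ∘ (id ⊗₁ ψ)) ⟩
    (ev ∘ (id ⊗₁ ψ)) ∘ pointʳ φ     ≡⟨ assoc ⟩
    ev ∘ ((id ⊗₁ ψ) ∘ pointʳ φ)     ≡⟨ cong (ev ∘_) (id⊗-pointʳ ψ φ) ⟩
    ev ∘ pointʳ (ψ ∘ φ)             ≡⟨ cong (λ u → ev ∘ pointʳ u) ψ∘φ≡φ′ ⟩
    bar _                           ∎

  s-com : S-com
  s-com = reindex swap , (bar-reindex swap∘⟨⟩ , bar-reindex swap∘⟨⟩) , bar-reindex swap∘⟨⟩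

  s-zero : S-zero
  s-zero f = curry ((f ∘ ρ⇒) ∘ (id ⊗₁ p₁)) , (first w₀ p₁-β , zero-second) , first Δ p₁-β
    where
    bar-witness : ∀ (φ : 𝟙 ⇒ I) → bar φ ∘ curry ((f ∘ ρ⇒) ∘ (id ⊗₁ p₁)) ≡ f ∘ (ρ⇒ ∘ pointʳ (p₁ ∘ φ))
    bar-witness φ = begin
      bar φ ∘ curry ((f ∘ ρ⇒) ∘ (id ⊗₁ p₁))   ≡⟨ bar-curry φ _ ⟩
      ((f ∘ ρ⇒) ∘ (id ⊗₁ p₁)) ∘ pointʳ φ      ≡⟨ trans assoc assoc ⟩
      f ∘ (ρ⇒ ∘ ((id ⊗₁ p₁) ∘ pointʳ φ))      ≡⟨ cong (λ u → f ∘ (ρ⇒ ∘ u)) (id⊗-pointʳ p₁ φ) ⟩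
      f ∘ (ρ⇒ ∘ pointʳ (p₁ ∘ φ))              ∎
    first : ∀ (φ : 𝟙 ⇒ I) → p₁ ∘ φ ≡ id → bar φ ∘ curry ((f ∘ ρ⇒) ∘ (id ⊗₁ p₁)) ≡ f
    first φ p₁∘φ≡id = begin
      bar φ ∘ curry ((f ∘ ρ⇒) ∘ (id ⊗₁ p₁))   ≡⟨ bar-witness φ ⟩
      f ∘ (ρ⇒ ∘ pointʳ (p₁ ∘ φ))              ≡⟨ cong (λ u → f ∘ (ρ⇒ ∘ pointʳ u)) p₁∘φ≡id ⟩
      f ∘ (ρ⇒ ∘ pointʳ id)                    ≡⟨ cong (f ∘_) pointʳ-id ⟩
      f ∘ id                                  ≡⟨ identityʳ ⟩
      f                                       ∎
    zero-second : bar w₁ ∘ curry ((f ∘ ρ⇒) ∘ (id ⊗₁ p₁)) ≡ 0m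
    zero-second = begin
      bar w₁ ∘ curry ((f ∘ ρ⇒) ∘ (id ⊗₁ p₁))  ≡⟨ bar-witness w₁ ⟩
      f ∘ (ρ⇒ ∘ pointʳ (p₁ ∘ w₁))             ≡⟨ cong (λ u → f ∘ (ρ⇒ ∘ pointʳ u)) p₁-β ⟩
      f ∘ (ρ⇒ ∘ pointʳ 0m)                    ≡⟨ cong (λ u → f ∘ (ρ⇒ ∘ u)) pointʳ-zero ⟩
      f ∘ (ρ⇒ ∘ 0m)                           ≡⟨ trans (cong (f ∘_) zeroʳ) zeroʳ ⟩
      0m                                      ∎

  S-witness⇒S-assoc : π-jointly-monic → S-witness → S-assoc
  S-witness⇒S-assoc monic witness {X} with
    witness {g₀ = S₁ (π₀ {X})} {g₁ = S₁ π₁}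
            (bar-natural w₀ π₀ , bar-natural w₁ π₀)
            (bar-natural w₀ π₁ , bar-natural w₁ π₁)
            (σ , sym (bar-natural Δ π₀) , sym (bar-natural Δ π₁))
  ... | c , π₀∘c≡Sπ₀ , π₁∘c≡Sπ₁ =
    c , exchange , monic (associative w₀ π₀∘c≡Sπ₀) (associative w₁ π₁∘c≡Sπ₁)
    where
    πⱼ∘c : ∀ j → π j {S X} ∘ c ≡ S₁ (π j)
    πⱼ∘c false = π₀∘c≡Sπ₀
    πⱼ∘c true  = π₁∘c≡Sπ₁
    exchange : ∀ i j → π i {X} ∘ (π j {S X} ∘ c) ≡ π j ∘ π i
    exchange i j = trans (cong (π i ∘_) (πⱼ∘c j)) (π-natural i (π j))
    associative : ∀ (φ : 𝟙 ⇒ I) → bar φ ∘ c ≡ S₁ (bar φ) → bar φ ∘ (S₁ σ ∘ c) ≡ bar φ ∘ σ {S X}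
    associative φ e = begin
      bar φ ∘ (S₁ σ ∘ c)   ≡⟨ sym assoc ⟩
      (bar φ ∘ S₁ σ) ∘ c   ≡⟨ cong (_∘ c) (bar-natural φ σ) ⟩
      (σ ∘ bar φ) ∘ c      ≡⟨ assoc ⟩
      σ ∘ (bar φ ∘ c)      ≡⟨ cong (σ ∘_) e ⟩
      σ ∘ S₁ (bar φ)       ≡⟨ bar-natural Δ (bar φ) ⟩
      bar φ ∘ σ            ∎

mainTheorem11 : ∀ {o ℓ} (L : CartesianPointedSMCC o ℓ) →
    (Summability.CanonicallySummable L →
       Summability.w-jointly-epic L × Summability.S-witness L)
    × (Summability.w-jointly-epic L × Summability.S-witness L →
       Summability.CanonicallySummable L)
mainTheorem11 L = necessary , sufficient
  where
  open CanonicalSummability L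
  open Summability L

  necessary : CanonicallySummable → w-jointly-epic × S-witness
  necessary (_ , monic , _ , _ , witness , _) = π-jointly-monic⇒w-jointly-epic monic , witness

  sufficient : w-jointly-epic × S-witness → CanonicallySummable
  sufficient (epic , witness) =
    S⊤-isZeroObject , monic , s-com , s-zero , witness , S-witness⇒S-assoc monic witness
    where
    monic : π-jointly-monic
    monic = w-jointly-epic⇒π-jointly-monic epic
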